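{- Let $r,s$ be positive integers, $k$ a positive integer divisible by $r+s$, $\alpha\ge0$ a good shift (for $r,s,k$), and $a=k+\alpha$. Let $$n=\bigl(ra+(r+s+s\alpha)\bigr)\left\lfloor\frac{\frac{sk}{r+s}-1}{r(r+s+s\alpha)}\right\rfloor,$$ and define $f:\{0,1,\ldots,n-1\}\to\{ -r,s\}$ by $f(j)=-r$ if $j\bmod a<\frac{sk}{r+s}-1$ and $f(j)=s$ if $j\bmod a\ge\frac{sk}{r+s}-1$ (where $j\bmod a\in\{0,\ldots,a-1\}$). Then every $k$-term arithmetic progression $A\subseteq\{0,1,\ldots,n-1\}$ satisfies $\sum_{j\in A}f(j)\ne0$.
   Context: For a nonnegative integer $\alpha$, $\mathcal S_\alpha=\{ -r\alpha,-r(\alpha-1)+s,\ldots,s\alpha\}$, the set of all possible sums of $\alpha$ numbers each equal to $-r$ or $s$. Given $k$ divisible by $r+s$, a nonnegative integer $\alpha$ is a good shift if no prime factor of $k+\alpha$ divides any element of $\mathcal S_\alpha$ (with the convention that every positive integer divides $0$). -}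

module Defs where

open import Data.Nat using (ℕ; zero; suc; _+_; _*_; _∸_; _<_; _≤_)
open import Data.Nat.DivMod using (_/_; _%_)
open import Data.Nat.Primality using (Prime)
open import Data.Nat.Divisibility as ℕD using ()
open import Data.Integer as ℤ using (ℤ; +_; -_)
open import Data.Integer.Divisibility as ℤD using ()
open import Relation.Nullary using (¬_)
open import Data.Bool using (if_then_else_)
open import Data.Nat using (_<ᵇ_)

-- Total floor division / remainder; only ever applied to positive divisors
-- under the theorem's hypotheses, where they agree with the usual ones.
_⌊/⌋_ : ℕ → ℕ → ℕ
x ⌊/⌋ zero = 0
x ⌊/⌋ suc d = x / suc d

_mod_ : ℕ → ℕ → ℕ
x mod zero = x
x mod suc d = x % suc d

-- The i-th element of S_α (0 ≤ i ≤ α):  -r(α - i) + s i  =  (r+s) i - r α.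
Selem : (r s α i : ℕ) → ℤ
Selem r s α i = (+ ((r + s) * i)) ℤ.- (+ (r * α))

-- α is a good shift for r, s, k: no prime factor p of k+α divides any
-- element of S_α (integer divisibility; every p divides 0).
GoodShift : (r s k α : ℕ) → Set
GoodShift r s k α =
  (p : ℕ) → Prime p → p ℕD.∣ (k + α) →
  (i : ℕ) → i ≤ α → ¬ ((+ p) ℤD.∣ Selem r s α i)

threshold : (r s k : ℕ) → ℕ
threshold r s k = ((s * k) ⌊/⌋ (r + s)) ∸ 1

nLen : (r s k α : ℕ) → ℕ
nLen r s k α =
  (r * (k + α) + (r + s + s * α)) *
  (threshold r s k ⌊/⌋ (r * (r + s + s * α)))

fColor : (r s k α : ℕ) → ℕ → ℤ
fColor r s k α j =
  if (j mod (k + α)) <ᵇ threshold r s k then - (+ r) else + s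

sumTo : ℕ → (ℕ → ℤ) → ℤ
sumTo zero g = + 0
sumTo (suc m) g = sumTo m g ℤ.+ g m

-- The colouring f has period a, so the sum W of f over any a-term progression
-- b, b + d, …, b + (a − 1) d is governed by g = gcd(d, a).  If a k-term
-- progression has sum 0, extending it to a terms gives W = (sum of the α extra
-- terms), an element of S_α.  If g = 1 the progression meets every residue
-- class mod a once, so W is the sum over a full period, which is
-- sα + r + s > sα ≥ max S_α.  If g > 1, a prime p ∣ g splits the progression
-- into p copies of the same a/p-term block, so p divides W ∈ S_α and p ∣ k + α,
-- against α being a good shift.
module Submission where

open import Defs
open import Data.Nat using (ℕ; zero; suc; pred; _+_; _*_; _∸_; _<_; _≤_; s≤s; _<ᵇ_)
open import Data.Nat using (NonZero; >-nonZero; >-nonZero⁻¹; ≢-nonZero; ≢-nonZero⁻¹)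
open import Data.Nat.Properties as ℕ using ()
open import Data.Nat.DivMod using ([m+kn]%n≡m%n; m<n⇒m%n≡m; m*n/n≡m)
open import Data.Nat.Divisibility using (_∣_; divides; ∣-trans; m∣m*n)
open import Data.Nat.GCD using (gcd; gcd[m,n]∣m; gcd[m,n]∣n; gcd[m,n]≢0; module Bézout)
open import Data.Nat.Coprimality using (Coprime; coprime?; gcd≡1⇒coprime; coprime-Bézout)
open import Data.Nat.Primality using (Prime)
open import Data.Nat.Primality.Factorisation using (factorise; PrimeFactorisation)
open import Data.Nat.ListAction using (product)
open import Data.List using ([]; _∷_)
open import Data.List.Relation.Unary.All using (All; []; _∷_)
open import Data.Integer as ℤ using (ℤ; +_; -_)
open import Data.Integer.Properties as ℤ using ()
import Data.Integer.Divisibility as ℤ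
open import Data.Integer.Tactic.RingSolver using (solve-∀)
import Data.Nat.Tactic.RingSolver as ℕ-Solver
open import Algebra.Properties.AbelianGroup ℤ.+-0-abelianGroup using (∙-cancelʳ)
open import Data.Bool using (true; false; if_then_else_)
open import Data.Product using (∃-syntax; _×_; _,_)
open import Data.Sum using (_⊎_; inj₁; inj₂)
open import Data.Empty using (⊥; ⊥-elim)
open import Relation.Nullary using (yes; no; ¬_)
open import Function using (case_of_)
open import Relation.Binary.PropositionalEquality

open Bézout using (+-; -+)

sumTo-cong : ∀ n {g h : ℕ → ℤ} → (∀ i → i < n → g i ≡ h i) → sumTo n g ≡ sumTo n h
sumTo-cong zero    g≗h = refl
sumTo-cong (suc n) g≗h =
  cong₂ ℤ._+_ (sumTo-cong n (λ i i<n → g≗h i (ℕ.m<n⇒m<1+n i<n))) (g≗h n ℕ.≤-refl)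

sumTo-+ : ∀ m n (g : ℕ → ℤ) → sumTo (m + n) g ≡ sumTo m g ℤ.+ sumTo n (λ j → g (m + j))
sumTo-+ m zero    g rewrite ℕ.+-identityʳ m = sym (ℤ.+-identityʳ _)
sumTo-+ m (suc n) g rewrite ℕ.+-suc m n =
  trans (cong (ℤ._+ g (m + n)) (sumTo-+ m n g))
        (ℤ.+-assoc (sumTo m g) (sumTo n (λ j → g (m + j))) (g (m + n)))

+n*c+c≡+[1+n]*c : ∀ n c → + n ℤ.* c ℤ.+ c ≡ + suc n ℤ.* c
+n*c+c≡+[1+n]*c n c = trans (ℤ.+-comm (+ n ℤ.* c) c) (sym (ℤ.suc-* (+ n) c))

sumTo-const : ∀ n c → sumTo n (λ _ → c) ≡ + n ℤ.* c
sumTo-const zero    c = sym (ℤ.*-zeroˡ c)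
sumTo-const (suc n) c = trans (cong (ℤ._+ c) (sumTo-const n c)) (+n*c+c≡+[1+n]*c n c)

sumTo-distrib : ∀ n (g h : ℕ → ℤ) → sumTo n (λ j → g j ℤ.+ h j) ≡ sumTo n g ℤ.+ sumTo n h
sumTo-distrib zero    g h = refl
sumTo-distrib (suc n) g h =
  trans (cong (ℤ._+ (g n ℤ.+ h n)) (sumTo-distrib n g h))
        (interchange (sumTo n g) (sumTo n h) (g n) (h n))
  where
  interchange : ∀ x y z w → (x ℤ.+ y) ℤ.+ (z ℤ.+ w) ≡ (x ℤ.+ z) ℤ.+ (y ℤ.+ w)
  interchange = solve-∀

sumTo-swap : ∀ m n (h : ℕ → ℕ → ℤ) →
  sumTo m (λ i → sumTo n (h i)) ≡ sumTo n (λ j → sumTo m (λ i → h i j))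
sumTo-swap zero    n h = sym (trans (sumTo-const n (+ 0)) (ℤ.*-zeroʳ (+ n)))
sumTo-swap (suc m) n h =
  trans (cong (ℤ._+ sumTo n (h m)) (sumTo-swap m n h))
        (sym (sumTo-distrib n (λ j → sumTo m (λ i → h i j)) (h m)))

sumTo-blocks : ∀ p q (g : ℕ → ℤ) →
  sumTo (p * q) g ≡ sumTo p (λ v → sumTo q (λ u → g (v * q + u)))
sumTo-blocks zero    q g = refl
sumTo-blocks (suc p) q g =
  trans (cong (λ n → sumTo n g) (ℕ.+-comm q (p * q)))
  (trans (sumTo-+ (p * q) q g)
         (cong (ℤ._+ sumTo q (λ u → g (p * q + u))) (sumTo-blocks p q g)))

sumTo-rotate : ∀ n (g : ℕ → ℤ) → g n ≡ g 0 → sumTo n (λ i → g (suc i)) ≡ sumTo n g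
sumTo-rotate n g gn≡g0 = ∙-cancelʳ (g 0) _ _ (begin
    sumTo n (λ i → g (suc i)) ℤ.+ g 0  ≡⟨ moveFirstToLast n g ⟩
    sumTo n g ℤ.+ g n                  ≡⟨ cong (λ x → sumTo n g ℤ.+ x) gn≡g0 ⟩
    sumTo n g ℤ.+ g 0                  ∎)
  where
  open ≡-Reasoning
  moveFirstToLast : ∀ n (g : ℕ → ℤ) → sumTo n (λ i → g (suc i)) ℤ.+ g 0 ≡ sumTo n g ℤ.+ g n
  moveFirstToLast zero    g = refl
  moveFirstToLast (suc n) g =
    trans (swapLast (sumTo n (λ i → g (suc i))) (g (suc n)) (g 0))
          (cong (ℤ._+ g (suc n)) (moveFirstToLast n g))
    where
    swapLast : ∀ x y z → (x ℤ.+ y) ℤ.+ z ≡ (x ℤ.+ z) ℤ.+ y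
    swapLast = solve-∀

sumTo-≤ : ∀ n {g : ℕ → ℤ} {c} → (∀ j → g j ℤ.≤ c) → sumTo n g ℤ.≤ + n ℤ.* c
sumTo-≤ zero    {c = c} g≤c = ℤ.≤-reflexive (sym (ℤ.*-zeroˡ c))
sumTo-≤ (suc n) {c = c} g≤c =
  subst (sumTo n _ ℤ.+ _ ℤ.≤_) (+n*c+c≡+[1+n]*c n c) (ℤ.+-mono-≤ (sumTo-≤ n g≤c) (g≤c n))

translation-invariant-* : ∀ {A : Set} (φ : ℕ → A) {d} → (∀ b → φ (b + d) ≡ φ b) →
  ∀ x b → φ (b + x * d) ≡ φ b
translation-invariant-* φ φ-+d zero    b = cong φ (ℕ.+-identityʳ b)
translation-invariant-* φ {d} φ-+d (suc x) b =
  trans (cong φ (trans (cong (λ z → b + z) (ℕ.+-comm d (x * d))) (sym (ℕ.+-assoc b (x * d) d))))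
        (trans (φ-+d (b + x * d)) (translation-invariant-* φ φ-+d x b))

bézout⇒constant : ∀ {A : Set} (φ : ℕ → A) {d a} → Bézout.Identity 1 d a →
  (∀ b → φ (b + d) ≡ φ b) → (∀ b → φ (b + a) ≡ φ b) → ∀ b → φ b ≡ φ 0
bézout⇒constant φ bz φ-+d φ-+a zero    = refl
bézout⇒constant φ {d} {a} bz φ-+d φ-+a (suc b) =
  trans (φ-suc bz) (bézout⇒constant φ bz φ-+d φ-+a b)
  where
  φ-suc : Bézout.Identity 1 d a → φ (suc b) ≡ φ b
  φ-suc (+- x y 1+ya≡xd) =
    trans (sym (translation-invariant-* φ φ-+a y (suc b)))
    (trans (cong φ (trans (sym (ℕ.+-suc b (y * a))) (cong (λ z → b + z) 1+ya≡xd)))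
           (translation-invariant-* φ φ-+d x b))
  φ-suc (-+ x y 1+xd≡ya) =
    trans (sym (translation-invariant-* φ φ-+d x (suc b)))
    (trans (cong φ (trans (sym (ℕ.+-suc b (x * d))) (cong (λ z → b + z) 1+xd≡ya)))
           (translation-invariant-* φ φ-+a y b))

+p∣+p*y : ∀ p y → + p ℤ.∣ + p ℤ.* y
+p∣+p*y p y = subst (p ∣_) (sym (ℤ.abs-* (+ p) y)) (m∣m*n ℤ.∣ y ∣)

module Periodic (a : ℕ) (F : ℕ → ℤ) (F-periodic : ∀ x t → F (x + t * a) ≡ F x) where

  window : ℕ → ℕ → ℤ
  window b d = sumTo a (λ i → F (b + i * d))

  sumTo-translate : ∀ x → sumTo a (λ j → F (j + x)) ≡ sumTo a F
  sumTo-translate zero    = sumTo-cong a (λ j _ → cong F (ℕ.+-identityʳ j))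
  sumTo-translate (suc x) =
    trans (sumTo-cong a (λ j _ → cong F (ℕ.+-suc j x)))
    (trans (sumTo-rotate a (λ j → F (j + x)) wrap) (sumTo-translate x))
    where
    wrap : F (a + x) ≡ F x
    wrap = trans (cong F (trans (ℕ.+-comm a x) (cong (λ z → x + z) (sym (ℕ.*-identityˡ a)))))
                 (F-periodic x 1)

  window-+d : ∀ b d → window (b + d) d ≡ window b d
  window-+d b d =
    trans (sumTo-cong a (λ i _ → cong F (ℕ.+-assoc b d (i * d))))
          (sumTo-rotate a (λ i → F (b + i * d)) wrap)
    where
    wrap : F (b + a * d) ≡ F (b + 0)
    wrap = trans (cong (λ z → F (b + z)) (ℕ.*-comm a d))
                 (trans (F-periodic b d) (cong F (sym (ℕ.+-identityʳ b))))

  window-+a : ∀ b d → window (b + a) d ≡ window b d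
  window-+a b d =
    sumTo-cong a (λ i _ → trans (cong F (reorder b a i d)) (F-periodic (b + i * d) 1))
    where
    reorder : ∀ b a i d → b + a + i * d ≡ b + i * d + 1 * a
    reorder = ℕ-Solver.solve-∀

  -- Summing the b-independent window over b < a gives a copies of the full-period sum.
  window-coprime : .{{_ : NonZero a}} → ∀ {d} → Coprime d a → ∀ b → window b d ≡ sumTo a F
  window-coprime {d} d⊥a b = trans (window-constant b) (ℤ.*-cancelˡ-≡ (+ a) _ _ (begin
      + a ℤ.* window 0 d                              ≡⟨ sumTo-const a (window 0 d) ⟨
      sumTo a (λ _ → window 0 d)                       ≡⟨ sumTo-cong a (λ b _ → window-constant b) ⟨
      sumTo a (λ b → window b d)                       ≡⟨ sumTo-swap a a (λ b i → F (b + i * d)) ⟩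
      sumTo a (λ i → sumTo a (λ b → F (b + i * d)))    ≡⟨ sumTo-cong a (λ i _ → sumTo-translate (i * d)) ⟩
      sumTo a (λ _ → sumTo a F)                        ≡⟨ sumTo-const a (sumTo a F) ⟩
      + a ℤ.* sumTo a F                                ∎))
    where
    open ≡-Reasoning
    window-constant : ∀ b → window b d ≡ window 0 d
    window-constant = bézout⇒constant (λ b → window b d) (coprime-Bézout d⊥a)
                        (λ b → window-+d b d) (λ b → window-+a b d)

  -- With a = q p and d = e p the progression is p repetitions of its first q terms.
  window-common-divisor : ∀ {p} b d → p ∣ a → p ∣ d → + p ℤ.∣ window b d
  window-common-divisor {p} b _ (divides q a≡qp) (divides e refl) =
    subst (+ p ℤ.∣_) (sym (begin
      window b (e * p)
        ≡⟨ cong (λ n → sumTo n G) (trans a≡qp (ℕ.*-comm q p)) ⟩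
      sumTo (p * q) G
        ≡⟨ sumTo-blocks p q G ⟩
      sumTo p (λ v → sumTo q (λ u → G (v * q + u)))
        ≡⟨ sumTo-cong p (λ v _ → sumTo-cong q (λ u _ → block v u)) ⟩
      sumTo p (λ _ → sumTo q G)
        ≡⟨ sumTo-const p (sumTo q G) ⟩
      + p ℤ.* sumTo q G ∎))
      (+p∣+p*y p (sumTo q G))
    where
    open ≡-Reasoning
    G : ℕ → ℤ
    G u = F (b + u * (e * p))
    shift : ∀ b v q u e p → b + (v * q + u) * (e * p) ≡ b + u * (e * p) + (v * e) * (q * p)
    shift = ℕ-Solver.solve-∀
    block : ∀ v u → G (v * q + u) ≡ G u
    block v u =
      trans (cong F (trans (shift b v q u e p) (cong (λ z → b + u * (e * p) + v * e * z) (sym a≡qp))))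
            (F-periodic (b + u * (e * p)) (v * e))

module _ (r s : ℕ) where

  Selem≡ : ∀ n i → Selem r s n i ≡ (+ r ℤ.+ + s) ℤ.* + i ℤ.- + r ℤ.* + n
  Selem≡ n i = cong₂ ℤ._-_ (trans (ℤ.pos-* (r + s) i) (cong (ℤ._* + i) (ℤ.pos-+ r s)))
                           (ℤ.pos-* r n)

  Selem-+-r : ∀ n i → Selem r s n i ℤ.+ - + r ≡ Selem r s (suc n) i
  Selem-+-r n i = trans (cong (ℤ._+ - + r) (Selem≡ n i))
                   (trans (identity (+ r) (+ s) (+ i) (+ n)) (sym (Selem≡ (suc n) i)))
    where
    identity : ∀ R S I N →
      ((R ℤ.+ S) ℤ.* I ℤ.- R ℤ.* N) ℤ.+ - R ≡ (R ℤ.+ S) ℤ.* I ℤ.- R ℤ.* (+ 1 ℤ.+ N)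
    identity = solve-∀

  Selem-+s : ∀ n i → Selem r s n i ℤ.+ + s ≡ Selem r s (suc n) (suc i)
  Selem-+s n i = trans (cong (ℤ._+ + s) (Selem≡ n i))
                  (trans (identity (+ r) (+ s) (+ i) (+ n)) (sym (Selem≡ (suc n) (suc i))))
    where
    identity : ∀ R S I N →
      ((R ℤ.+ S) ℤ.* I ℤ.- R ℤ.* N) ℤ.+ S ≡ (R ℤ.+ S) ℤ.* (+ 1 ℤ.+ I) ℤ.- R ℤ.* (+ 1 ℤ.+ N)
    identity = solve-∀

  sumTo∈S : ∀ n (h : ℕ → ℤ) → (∀ j → h j ≡ - + r ⊎ h j ≡ + s) →
    ∃[ i ] i ≤ n × sumTo n h ≡ Selem r s n i
  sumTo∈S zero    h h-values = 0 , ℕ.≤-refl , sym (trans (Selem≡ 0 0) (vanish (+ r) (+ s)))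
    where
    vanish : ∀ R S → (R ℤ.+ S) ℤ.* + 0 ℤ.- R ℤ.* + 0 ≡ + 0
    vanish = solve-∀
  sumTo∈S (suc n) h h-values with sumTo∈S n h h-values | h-values n
  ... | i , i≤n , sum≡ | inj₁ hn≡-r =
    i , ℕ.m≤n⇒m≤1+n i≤n , trans (cong₂ ℤ._+_ sum≡ hn≡-r) (Selem-+-r n i)
  ... | i , i≤n , sum≡ | inj₂ hn≡s =
    suc i , s≤s i≤n , trans (cong₂ ℤ._+_ sum≡ hn≡s) (Selem-+s n i)

  sumTo≤n*s : ∀ n (h : ℕ → ℤ) → (∀ j → h j ≡ - + r ⊎ h j ≡ + s) → sumTo n h ℤ.≤ + (n * s)
  sumTo≤n*s n h h-values = subst (sumTo n h ℤ.≤_) (sym (ℤ.pos-* n s)) (sumTo-≤ n h≤s)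
    where
    h≤s : ∀ j → h j ℤ.≤ + s
    h≤s j with h-values j
    ... | inj₁ hj≡-r = subst (ℤ._≤ + s) (sym hj≡-r) ℤ.neg-≤-pos
    ... | inj₂ hj≡s  = ℤ.≤-reflexive hj≡s

mod-periodic : ∀ x t n → (x + t * n) mod n ≡ x mod n
mod-periodic x t zero    = trans (cong (λ z → x + z) (ℕ.*-zeroʳ t)) (ℕ.+-identityʳ x)
mod-periodic x t (suc n) = [m+kn]%n≡m%n x t (suc n)

m<n⇒m-mod-n≡m : ∀ {m n} → m < n → m mod n ≡ m
m<n⇒m-mod-n≡m {n = suc n} m<n = m<n⇒m%n≡m m<n

m*n⌊/⌋n≡m : ∀ m n .{{_ : NonZero n}} → (m * n) ⌊/⌋ n ≡ m
m*n⌊/⌋n≡m m (suc n) = m*n/n≡m m (suc n)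

sumTo-step : ∀ t u (x y : ℤ) →
  sumTo (t + u) (λ j → if j <ᵇ t then x else y) ≡ + t ℤ.* x ℤ.+ + u ℤ.* y
sumTo-step t u x y = trans (sumTo-+ t u _)
  (cong₂ ℤ._+_ (trans (sumTo-cong t below) (sumTo-const t x))
               (trans (sumTo-cong u above) (sumTo-const u y)))
  where
  below : ∀ j → j < t → (if j <ᵇ t then x else y) ≡ x
  below j j<t with j <ᵇ t | ℕ.<⇒<ᵇ j<t
  ... | true | _ = refl
  above : ∀ j → j < u → (if t + j <ᵇ t then x else y) ≡ y
  above j _ with t + j <ᵇ t | ℕ.<ᵇ⇒< (t + j) t
  ... | false | _          = refl
  ... | true  | t+j<ᵇt⇒t+j<t = ⊥-elim (ℕ.m+n≮m t j (t+j<ᵇt⇒t+j<t _))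

fColor-periodic : ∀ r s k α x t → fColor r s k α (x + t * (k + α)) ≡ fColor r s k α x
fColor-periodic r s k α x t =
  cong (λ z → if z <ᵇ threshold r s k then - + r else + s) (mod-periodic x t (k + α))

fColor-values : ∀ r s k α j → fColor r s k α j ≡ - + r ⊎ fColor r s k α j ≡ + s
fColor-values r s k α j with (j mod (k + α)) <ᵇ threshold r s k
... | true  = inj₁ refl
... | false = inj₂ refl

module PeriodSum (r s w α : ℕ) .{{_ : NonZero r}} .{{_ : NonZero s}} .{{_ : NonZero w}} where

  t u : ℕ
  t = pred (s * w)
  u = w * r + 1 + α

  suc-t : suc t ≡ s * w
  suc-t = ℕ.suc-pred (s * w) {{ℕ.m*n≢0 s w}}

  threshold≡t : threshold r s (w * (r + s)) ≡ t
  threshold≡t = cong pred (trans (cong (_⌊/⌋ (r + s)) (sym (ℕ.*-assoc s w (r + s))))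
                                 (m*n⌊/⌋n≡m (s * w) (r + s) {{r+s≢0}}))
    where
    r+s≢0 : NonZero (r + s)
    r+s≢0 = >-nonZero (ℕ.<-≤-trans (>-nonZero⁻¹ r) (ℕ.m≤m+n r s))

  period≡t+u : w * (r + s) + α ≡ t + u
  period≡t+u = begin
    w * (r + s) + α      ≡⟨ regroup w r s α ⟩
    s * w + (w * r + α)  ≡⟨ cong (_+ (w * r + α)) (sym suc-t) ⟩
    suc t + (w * r + α)  ≡⟨ regroup′ t w r α ⟩
    t + u                ∎
    where
    open ≡-Reasoning
    regroup : ∀ w r s α → w * (r + s) + α ≡ s * w + (w * r + α)
    regroup = ℕ-Solver.solve-∀
    regroup′ : ∀ t w r α → suc t + (w * r + α) ≡ t + (w * r + 1 + α)
    regroup′ = ℕ-Solver.solve-∀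

  u*s≡t*r+excess : u * s ≡ t * r + (α * s + (r + s))
  u*s≡t*r+excess = begin
    (w * r + 1 + α) * s          ≡⟨ expand w r s α ⟩
    s * w * r + (α * s + s)      ≡⟨ cong (λ z → z * r + (α * s + s)) (sym suc-t) ⟩
    suc t * r + (α * s + s)      ≡⟨ collect t r s α ⟩
    t * r + (α * s + (r + s))    ∎
    where
    open ≡-Reasoning
    expand : ∀ w r s α → (w * r + 1 + α) * s ≡ s * w * r + (α * s + s)
    expand = ℕ-Solver.solve-∀
    collect : ∀ t r s α → suc t * r + (α * s + s) ≡ t * r + (α * s + (r + s))
    collect = ℕ-Solver.solve-∀

  fColor-period-sum : sumTo (w * (r + s) + α) (fColor r s (w * (r + s)) α) ≡ + (α * s + (r + s))
  fColor-period-sum = begin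
    sumTo (w * (r + s) + α) (fColor r s (w * (r + s)) α)
      ≡⟨ sumTo-cong (w * (r + s) + α) (λ j j<a → cong₂ (λ z θ → if z <ᵇ θ then - + r else + s)
                                       (m<n⇒m-mod-n≡m j<a) threshold≡t) ⟩
    sumTo (w * (r + s) + α) (λ j → if j <ᵇ t then - + r else + s)
      ≡⟨ cong (λ n → sumTo n (λ j → if j <ᵇ t then - + r else + s)) period≡t+u ⟩
    sumTo (t + u) (λ j → if j <ᵇ t then - + r else + s)
      ≡⟨ sumTo-step t u (- + r) (+ s) ⟩
    + t ℤ.* - + r ℤ.+ + u ℤ.* + s
      ≡⟨ cong₂ ℤ._+_ (trans (sym (ℤ.neg-distribʳ-* (+ t) (+ r))) (cong -_ (sym (ℤ.pos-* t r))))
                     (trans (sym (ℤ.pos-* u s)) (cong +_ u*s≡t*r+excess)) ⟩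
    - + (t * r) ℤ.+ + (t * r + (α * s + (r + s)))
      ≡⟨ cong (λ z → - + (t * r) ℤ.+ z) (ℤ.pos-+ (t * r) (α * s + (r + s))) ⟩
    - + (t * r) ℤ.+ (+ (t * r) ℤ.+ + (α * s + (r + s)))
      ≡⟨ cancel (+ (t * r)) (+ (α * s + (r + s))) ⟩
    + (α * s + (r + s))  ∎
    where
    open ≡-Reasoning
    cancel : ∀ m x → - m ℤ.+ (m ℤ.+ x) ≡ x
    cancel = solve-∀

prime-divisor : ∀ n .{{_ : NonZero n}} → n ≢ 1 → ∃[ p ] Prime p × p ∣ n
prime-divisor n n≢1 =
  head (PrimeFactorisation.factors fact) (PrimeFactorisation.isFactorisation fact)
       (PrimeFactorisation.factorsPrime fact)
  where
  fact : PrimeFactorisation n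
  fact = factorise n
  head : ∀ ps → n ≡ product ps → All Prime ps → ∃[ p ] Prime p × p ∣ n
  head []       n≡1 _            = ⊥-elim (n≢1 n≡1)
  head (p ∷ ps) n≡∏ (p-prime ∷ _) =
    p , p-prime , divides (product ps) (trans n≡∏ (ℕ.*-comm p (product ps)))

¬coprime⇒prime-common-divisor : ∀ m n .{{_ : NonZero n}} → ¬ Coprime m n →
  ∃[ p ] Prime p × p ∣ m × p ∣ n
¬coprime⇒prime-common-divisor m n ¬m⊥n
  with prime-divisor (gcd m n) {{≢-nonZero (gcd[m,n]≢0 m n (inj₂ (≢-nonZero⁻¹ n)))}}
                     (λ gcd≡1 → ¬m⊥n (gcd≡1⇒coprime gcd≡1))
... | p , p-prime , p∣gcd = p , p-prime , ∣-trans p∣gcd (gcd[m,n]∣m m n) , ∣-trans p∣gcd (gcd[m,n]∣n m n)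

proposition4p6 : (r s k α : ℕ) → 0 < r → 0 < s → 0 < k → (r + s) ∣ k →
    GoodShift r s k α →
    (b d : ℕ) → 0 < d → b + (k ∸ 1) * d < nLen r s k α →
    sumTo k (λ i → fColor r s k α (b + i * d)) ≢ + 0
proposition4p6 r s _ α _ _ () (divides zero refl)
proposition4p6 r s _ α 0<r 0<s 0<k (divides w@(suc _) refl) isGood b d _ _ sum≡0 =
  case coprime? d a of λ where
    (yes d⊥a) → coprime-case d⊥a
    (no ¬d⊥a) → common-prime-case (¬coprime⇒prime-common-divisor d a ¬d⊥a)
  where
  k a : ℕ
  k = w * (r + s)
  a = k + α
  instance
    r≢0 : NonZero r
    r≢0 = >-nonZero 0<r
    s≢0 : NonZero s
    s≢0 = >-nonZero 0<s
    a≢0 : NonZero a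
    a≢0 = >-nonZero (ℕ.<-≤-trans 0<k (ℕ.m≤m+n k α))
  open Periodic a (fColor r s k α) (fColor-periodic r s k α)
  open PeriodSum r s w α

  tail-term : ℕ → ℤ
  tail-term j = fColor r s k α (b + (k + j) * d)
  window≡tail : window b d ≡ sumTo α tail-term
  window≡tail = trans (sumTo-+ k α _)
    (trans (cong (ℤ._+ sumTo α tail-term) sum≡0) (ℤ.+-identityˡ (sumTo α tail-term)))
  tail-values : ∀ j → tail-term j ≡ - + r ⊎ tail-term j ≡ + s
  tail-values j = fColor-values r s k α (b + (k + j) * d)

  coprime-case : Coprime d a → ⊥
  coprime-case d⊥a = ℕ.<⇒≱ (ℕ.m<m+n (α * s) (ℕ.<-≤-trans 0<r (ℕ.m≤m+n r s)))
    (ℤ.drop‿+≤+ (subst (ℤ._≤ + (α * s)) tail≡period-sum (sumTo≤n*s r s α tail-term tail-values)))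
    where
    tail≡period-sum : sumTo α tail-term ≡ + (α * s + (r + s))
    tail≡period-sum = trans (sym window≡tail) (trans (window-coprime d⊥a b) fColor-period-sum)

  common-prime-case : ∃[ p ] Prime p × p ∣ d × p ∣ a → ⊥
  common-prime-case (p , p-prime , p∣d , p∣a) with sumTo∈S r s α tail-term tail-values
  ... | i , i≤α , tail≡Selem = isGood p p-prime p∣a i i≤α
    (subst (+ p ℤ.∣_) (trans window≡tail tail≡Selem) (window-common-divisor b d p∣a p∣d))
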